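{- Let $T_1$ be a heap-ordered tree, let $v,w$ be nodes of $T_1$ with $u=\mathit{nca}_{T_1}(v,w)\notin\{v,w\}$, and let $T$ be the tree produced by $\mathit{merge}(v,w)$. Let $T_1'$ be a rooted tree equivalent to $T_1$, rerooted at $v$, and let $r$ be the parent of $u$ in $T_1'$. Let $T'$ be the tree formed from $T_1'$ by deleting the arc from $u$ to $r$ and then adding an arc from $v$ to $w$ (making $w$ the parent of $v$). Then $T'$ is equivalent to $T$.
   Context: A heap-ordered tree is a rooted tree whose nodes are distinct elements of a totally ordered set, with every non-root node greater than its parent. $\mathit{merge}(v,w)$: letting $P$ and $Q$ be the paths from $v$ and $w$ to the root, every node $z\in P\cup Q$ gets as its new parent the largest node of $P\cup Q$ smaller than $z$ (no parent if none), while all other nodes keep their parents. For a tree $S$ and nodes $a,b$ of $S$, $S[a,b]$ denotes the set of nodes on the unique path connecting $a$ and $b$ in $S$, ignoring arc directions. Two rooted trees $S$ and $S'$ (nodes from a totally ordered set; $S'$ need not be heap-ordered) are equivalent if they have the same node set and $\min(S[a,b])=\min(S'[a,b])$ for all nodes $a,b$. Rerooting a tree at $v$ means reversing the direction of every arc on the path from $v$ to the root. -}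

module Defs where

open import Data.Nat using (ℕ)
open import Data.Fin using (Fin; _<_; _≤_; _≟_)
open import Data.Maybe using (Maybe; just; nothing)
open import Data.Product using (Σ; ∃; _×_; _,_)
open import Data.Sum using (_⊎_)
open import Relation.Nullary using (¬_; yes; no)
open import Relation.Binary.PropositionalEquality using (_≡_)

-- A rooted (directed) forest-like structure on the node set Fin n,
-- given by a parent function (nothing = no parent).
-- Nodes are the elements of Fin n, totally ordered by Fin's order.
Parents : ℕ → Set
Parents n = Fin n → Maybe (Fin n)

module _ {n : ℕ} (p : Parents n) where

  data Reaches : Fin n → Set where
    atRoot : ∀ {x} → p x ≡ nothing → Reaches x
    up     : ∀ {x y} → p x ≡ just y → Reaches y → Reaches x

  record IsRootedTree : Set where
    field
      root       : Fin n
      root-isRoot : p root ≡ nothing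
      root-unique : ∀ x → p x ≡ nothing → x ≡ root
      reaches    : ∀ x → Reaches x

  IsHeapOrdered : Set
  IsHeapOrdered = IsRootedTree × (∀ x y → p x ≡ just y → y < x)

  -- Anc z x : z lies on the path from x to the root (z is an ancestor-or-self of x)
  data Anc : Fin n → Fin n → Set where
    here : ∀ {x} → Anc x x
    step : ∀ {x y z} → p x ≡ just y → Anc z y → Anc z x

  IsNCA : Fin n → Fin n → Fin n → Set
  IsNCA a b u = Anc u a × Anc u b × (∀ c → Anc c a → Anc c b → Anc c u)

  -- z ∈ S[a,b]: z lies on the path from a (or b) up to nca(a,b)
  OnPath : Fin n → Fin n → Fin n → Set
  OnPath a b z =
    ((Anc z a ⊎ Anc z b) × (∀ c → Anc c a → Anc c b → Anc c z))

  PathMin : Fin n → Fin n → Fin n → Set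
  PathMin a b m = OnPath a b m × (∀ z → OnPath a b z → m ≤ z)

Equivalent : ∀ {n} → Parents n → Parents n → Set
Equivalent p p' = ∀ a b m → (PathMin p a b m → PathMin p' a b m)
                          × (PathMin p' a b m → PathMin p a b m)

IsMerge : ∀ {n} → Parents n → Fin n → Fin n → Parents n → Set
IsMerge {n} p v w q = ∀ z →
    (InPQ z →
      (q z ≡ nothing × (∀ y → InPQ y → ¬ (y < z)))
      ⊎ (∃ λ y → q z ≡ just y × InPQ y × y < z
                 × (∀ y' → InPQ y' → y' < z → y' ≤ y)))
  × (¬ InPQ z → q z ≡ p z)
  where
  InPQ : Fin n → Set
  InPQ z = Anc p z v ⊎ Anc p z w

-- s' is s rerooted at v: arcs on the path from v to the root are reversed
IsReroot : ∀ {n} → Parents n → Fin n → Parents n → Set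
IsReroot s v s' = s' v ≡ nothing
  × (∀ z → Anc s z v → ¬ (z ≡ v) →
       ∃ λ y → s y ≡ just z × Anc s y v × s' z ≡ just y)
  × (∀ z → ¬ Anc s z v → s' z ≡ s z)

cutLink : ∀ {n} → Parents n → Fin n → Fin n → Fin n → Parents n
cutLink s u v w z with z ≟ v
... | yes _ = just w
... | no _ with z ≟ u
...   | yes _ = nothing
...   | no _ = s z

-- Call a and b k-connected in a rooted tree when a walk along its arcs joins them
-- through nodes ≥ k.  Every walk from a to b visits all of S[a,b], and S[a,b] is
-- itself such a walk, so min S[a,b] is the largest k for which a and b are
-- k-connected.  Rooted trees are thus equivalent iff they have the same
-- k-connectivity, which follows once each arc x–y of either tree joins x and y
-- through nodes ≥ min(x,y) in the other.  Rerooting keeps the arcs, so T₁, S and T₁′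
-- have the same connectivity.  Merging turns the arcs on P ∪ Q into chains
-- descending through P ∪ Q, which join the ends of every arc of T₁ as well as v and
-- w; conversely a merged arc z → y stays in P ∪ Q, where T₁ plus the arc v–w joins z
-- and y above y.  The cut-link tree has the arcs of T₁′ except u–r, plus v–w, and
-- u, r stay joined above u via w ⇝ u and r ⇝ v since u = min S[v,w].

module Submission where

open import Defs
open import Data.Nat using (ℕ)
import Data.Nat.Properties as ℕ
open import Data.Fin using (Fin; _≤_; _<_; _≟_)
open import Data.Fin.Properties using (≤-refl; ≤-trans; ≤-reflexive; ≤-antisym; ≤-total; ≤∧≢⇒<)
open import Data.Fin.Induction using (<-wellFounded)
open import Induction.WellFounded using (Acc; acc)
open import Data.Maybe using (just; nothing)
open import Data.Maybe.Properties using (just-injective)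
open import Data.Product using (Σ; ∃; _×_; _,_; proj₁; proj₂)
open import Data.Sum using (_⊎_; inj₁; inj₂; [_,_]; swap)
open import Data.Empty using (⊥-elim)
open import Function using (id; _∘_)
open import Relation.Nullary using (¬_; yes; no; Dec)
open import Relation.Nullary.Decidable using (toSum)
open import Relation.Binary.PropositionalEquality using (_≡_; _≢_; refl; sym; trans; subst)
open import Relation.Binary.Construct.Closure.ReflexiveTransitive using (Star; ε; _◅_; _◅◅_; reverse)

module _ {n : ℕ} {p : Parents n} where

  anc-trans : ∀ {x y z} → Anc p z y → Anc p y x → Anc p z x
  anc-trans zy here        = zy
  anc-trans zy (step e yx) = step e (anc-trans zy yx)

  anc-parent : ∀ {x y} → p x ≡ just y → Anc p y x
  anc-parent e = step e here

  anc-step⁻¹ : ∀ {x y z} → p x ≡ just y → Anc p z x → z ≡ x ⊎ Anc p z y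
  anc-step⁻¹ e here = inj₁ refl
  anc-step⁻¹ e (step e′ a) with trans (sym e) e′
  ... | refl = inj₂ a

  anc-total : ∀ {a y z} → Anc p y a → Anc p z a → Anc p y z ⊎ Anc p z y
  anc-total here        za           = inj₂ za
  anc-total (step e ya) here         = inj₁ (step e ya)
  anc-total (step e ya) (step e′ za) with trans (sym e) e′
  ... | refl = anc-total ya za

  anc-parentless : ∀ {x y} → p x ≡ nothing → Anc p y x → y ≡ x
  anc-parentless e here        = refl
  anc-parentless e (step e′ _) with trans (sym e) e′
  ... | ()

  reaches⇒parent≢self : ∀ {x} → Reaches p x → p x ≢ just x
  reaches⇒parent≢self (atRoot e) e′ with trans (sym e) e′
  ... | ()
  reaches⇒parent≢self (up e r) e′ with trans (sym e) e′
  ... | refl = reaches⇒parent≢self r e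

  anc-antisym : ∀ {x y} → Reaches p x → Anc p y x → Anc p x y → x ≡ y
  anc-antisym r          here         _  = refl
  anc-antisym (atRoot e) (step e′ _)  _  with trans (sym e) e′
  ... | ()
  anc-antisym {x} (up e r) (step e′ yx′) xy with trans (sym e) e′
  ... | refl = ⊥-elim (reaches⇒parent≢self (up e r)
                 (subst (λ t → p x ≡ just t) (anc-antisym r (anc-trans xy yx′) (anc-parent e)) e))

  anc? : ∀ {y} → Reaches p y → ∀ x → Dec (Anc p x y)
  anc? {y} r x with x ≟ y
  ... | yes refl = yes here
  anc? (atRoot e) x | no x≢y = no (x≢y ∘ anc-parentless e)
  anc? (up e r)   x | no x≢y with anc? r x
  ...   | yes a = yes (step e a)
  ...   | no ¬a = no ([ x≢y , ¬a ] ∘ anc-step⁻¹ e)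

  reaches-anc : ∀ {x y} → Anc p y x → Reaches p y → Reaches p x
  reaches-anc here       r = r
  reaches-anc (step e a) r = up e (reaches-anc a r)

module _ {n : ℕ} (p : Parents n) where

  Arc≥ : Fin n → Fin n → Fin n → Set
  Arc≥ k x y = k ≤ x × k ≤ y × (p x ≡ just y ⊎ p y ≡ just x)

  Walk≥ : Fin n → Fin n → Fin n → Set
  Walk≥ k = Star (Arc≥ k)

  Connected≥ : Fin n → Fin n → Fin n → Set
  Connected≥ k a b = k ≤ a × Walk≥ k a b

  arc-walk : ∀ {k x y} → p x ≡ just y → k ≤ x → k ≤ y → Walk≥ k x y
  arc-walk e kx ky = (kx , ky , inj₁ e) ◅ ε

  walk-reverse : ∀ {k x y} → Walk≥ k x y → Walk≥ k y x
  walk-reverse = reverse λ (kx , ky , e) → ky , kx , swap e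

  walk-antitone : ∀ {k k′ x y} → k ≤ k′ → Walk≥ k′ x y → Walk≥ k x y
  walk-antitone k≤k′ ε = ε
  walk-antitone k≤k′ ((kx , ky , e) ◅ s) = (≤-trans k≤k′ kx , ≤-trans k≤k′ ky , e) ◅ walk-antitone k≤k′ s

module _ {n : ℕ} where

  ArcsBridged : Parents n → Parents n → Set
  ArcsBridged p q = ∀ {k x y} → p x ≡ just y → k ≤ x → k ≤ y → Walk≥ q k x y

  KeepsConnectivity : Parents n → Parents n → Set
  KeepsConnectivity p q = ∀ {k a b} → Connected≥ p k a b → Connected≥ q k a b

  bridged-walk : ∀ {p q} → ArcsBridged p q → ∀ {k a b} → Walk≥ p k a b → Walk≥ q k a b
  bridged-walk f ε = ε
  bridged-walk f ((kx , ky , inj₁ e) ◅ s) = f e kx ky ◅◅ bridged-walk f s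
  bridged-walk {q = q} f ((kx , ky , inj₂ e) ◅ s) = walk-reverse q (f e ky kx) ◅◅ bridged-walk f s

  bridged⇒keepsConnectivity : ∀ {p q} → ArcsBridged p q → KeepsConnectivity p q
  bridged⇒keepsConnectivity f (ka , s) = ka , bridged-walk f s

  arcs⇒bridged : ∀ {p q} → (∀ {x y} → p x ≡ just y → q x ≡ just y ⊎ q y ≡ just x) → ArcsBridged p q
  arcs⇒bridged {q = q} arc e kx ky with arc e
  ... | inj₁ e′ = arc-walk q e′ kx ky
  ... | inj₂ e′ = walk-reverse q (arc-walk q e′ ky kx)

  ancestor-walk : ∀ {p q : Parents n} {k x y} → Anc p y x →
    (∀ z → Anc p z x → Anc p y z → z ≢ y → q z ≡ p z) →
    (∀ z → Anc p z x → Anc p y z → k ≤ z) →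
    Walk≥ q k x y × Anc q y x
  ancestor-walk here agree above = ε , here
  ancestor-walk {x = x} {y} (step e yx′) agree above with x ≟ y
  ... | yes refl = ε , here
  ... | no x≢y with ancestor-walk yx′ (λ z zx′ → agree z (step e zx′)) (λ z zx′ → above z (step e zx′))
  ...   | s , yx = (above x here (step e yx′) , above _ (anc-parent e) yx′ , inj₁ e′) ◅ s , step e′ yx
    where e′ = trans (agree x here (step e yx′) x≢y) e

  ancestor-walk-self : ∀ {p : Parents n} {k x y} → Anc p y x →
    (∀ z → Anc p z x → Anc p y z → k ≤ z) → Walk≥ p k x y
  ancestor-walk-self yx above = proj₁ (ancestor-walk yx (λ _ _ _ _ → refl) above)

module RootedTree {n : ℕ} {p : Parents n} (t : IsRootedTree p) where
  open IsRootedTree t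

  root-anc : ∀ x → Anc p root x
  root-anc x = go (reaches x)
    where
    go : ∀ {x} → Reaches p x → Anc p root x
    go (atRoot e) = subst (Anc p root) (sym (root-unique _ e)) here
    go (up e r)   = step e (go r)

  parentless-anc : ∀ {x} y → p x ≡ nothing → Anc p x y
  parentless-anc y e = subst (λ t → Anc p t y) (sym (root-unique _ e)) (root-anc y)

  anc-root⇒anc : ∀ {c} z → Anc p c root → Anc p c z
  anc-root⇒anc z c-root = subst (λ t → Anc p t z) (sym (anc-parentless root-isRoot c-root)) (root-anc z)

  parent-not-anc : ∀ {c x} → p c ≡ just x → ¬ Anc p c x
  parent-not-anc {c} e cx = reaches⇒parent≢self (reaches c)
    (subst (λ t → p c ≡ just t) (sym (anc-antisym (reaches c) (anc-parent e) cx)) e)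

  same-parent-on-chain : ∀ {v c y x} → Anc p c v → Anc p y v → p c ≡ just x → p y ≡ just x → c ≡ y
  same-parent-on-chain cv yv ec ey with anc-total cv yv
  ... | inj₁ cy = [ id , ⊥-elim ∘ parent-not-anc ec ] (anc-step⁻¹ ey cy)
  ... | inj₂ yc = [ sym , ⊥-elim ∘ parent-not-anc ey ] (anc-step⁻¹ ec yc)

  nca-exists : ∀ a b → ∃ (IsNCA p a b)
  nca-exists a b = go (reaches b)
    where
    go : ∀ {b} → Reaches p b → ∃ (IsNCA p a b)
    go {b} r with anc? (reaches a) b
    ... | yes ba = b , ba , here , λ _ _ cb → cb
    go {b} (atRoot e) | no ¬ba = ⊥-elim (¬ba (parentless-anc a e))
    go {b} (up e r)   | no ¬ba with go r
    ...   | c , ca , cb , common =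
            c , ca , step e cb ,
            λ c′ c′a c′b → [ (λ { refl → ⊥-elim (¬ba c′a) }) , common c′ c′a ] (anc-step⁻¹ e c′b)

  segment-min : ∀ {c x} → Anc p c x →
    Σ (Fin n) λ m → (Anc p m x × Anc p c m) × (∀ z → Anc p z x → Anc p c z → m ≤ z)
  segment-min {c} here = c , (here , here) , λ z zc cz → ≤-reflexive (anc-antisym (reaches c) zc cz)
  segment-min {x = x} (step e cy) with segment-min cy
  ... | m , (my , cm) , m-min with ≤-total x m
  ...   | inj₁ x≤m = x , (here , step e cy) ,
          λ z zx cz → [ ≤-reflexive ∘ sym , (λ zy → ≤-trans x≤m (m-min z zy cz)) ] (anc-step⁻¹ e zx)
  ...   | inj₂ m≤x = m , (step e my , cm) ,
          λ z zx cz → [ (λ { refl → m≤x }) , (λ zy → m-min z zy cz) ] (anc-step⁻¹ e zx)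

  nca-onPath : ∀ {a b c z} → IsNCA p a b c → Anc p z a ⊎ Anc p z b → Anc p c z → OnPath p a b z
  nca-onPath (_ , _ , common) za cz = za , λ c′ c′a c′b → anc-trans (common c′ c′a c′b) cz

  pathMin-exists : ∀ a b → ∃ (PathMin p a b)
  pathMin-exists a b with nca-exists a b
  ... | c , nca@(ca , cb , _) with segment-min ca | segment-min cb
  ...   | m₁ , (m₁a , cm₁) , min₁ | m₂ , (m₂b , cm₂) , min₂ = pick (≤-total m₁ m₂)
    where
    c-anc : ∀ {z} → OnPath p a b z → Anc p c z
    c-anc (_ , common) = common c ca cb
    pick : m₁ ≤ m₂ ⊎ m₂ ≤ m₁ → ∃ (PathMin p a b)
    pick (inj₁ m₁≤m₂) = m₁ , nca-onPath nca (inj₁ m₁a) cm₁ ,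
      λ z op → [ (λ za → min₁ z za (c-anc op)) , (λ zb → ≤-trans m₁≤m₂ (min₂ z zb (c-anc op))) ] (proj₁ op)
    pick (inj₂ m₂≤m₁) = m₂ , nca-onPath nca (inj₂ m₂b) cm₂ ,
      λ z op → [ (λ za → ≤-trans m₂≤m₁ (min₁ z za (c-anc op))) , (λ zb → min₂ z zb (c-anc op)) ] (proj₁ op)

  onPath-self : ∀ {a z} → OnPath p a a z → z ≡ a
  onPath-self {a} (za , common) = sym (anc-antisym (reaches a) ([ id , id ] za) (common a here here))

  onPath-up : ∀ {a a′ b z} → p a ≡ just a′ → z ≢ a → OnPath p a b z → OnPath p a′ b z
  onPath-up e z≢a (za⊎zb , common) =
    [ inj₁ ∘ [ ⊥-elim ∘ z≢a , id ] ∘ anc-step⁻¹ e , inj₂ ] za⊎zb ,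
    λ c ca′ cb → common c (step e ca′) cb

  onPath-of-common-anc : ∀ {a b z} → OnPath p a b z → Anc p z a → Anc p a b → z ≡ a
  onPath-of-common-anc {a} (_ , common) za ab = sym (anc-antisym (reaches a) za (common a here ab))

  child-on-path-anc : ∀ {a a′ b z} → p a′ ≡ just a → z ≢ a → OnPath p a b z → Anc p a′ b → Anc p a′ z
  child-on-path-anc e z≢a op@(inj₁ za , _) a′b =
    ⊥-elim (z≢a (onPath-of-common-anc op za (anc-trans (anc-parent e) a′b)))
  child-on-path-anc e z≢a op@(inj₂ zb , _) a′b with anc-total a′b zb
  ... | inj₁ a′z = a′z
  ... | inj₂ za′ with anc-step⁻¹ e za′
  ...   | inj₁ refl = here
  ...   | inj₂ za = ⊥-elim (z≢a (onPath-of-common-anc op za (anc-trans (anc-parent e) a′b)))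

  onPath-down : ∀ {a a′ b z} → p a′ ≡ just a → z ≢ a → OnPath p a b z → OnPath p a′ b z
  onPath-down e z≢a op@(za⊎zb , common) =
    [ inj₁ ∘ step e , inj₂ ] za⊎zb ,
    λ c ca′ cb → [ (λ { refl → child-on-path-anc e z≢a op cb }) , (λ ca → common c ca cb) ]
                   (anc-step⁻¹ e ca′)

  onPath-arc : ∀ {k a a′ b z} → Arc≥ p k a a′ → z ≢ a → OnPath p a b z → OnPath p a′ b z
  onPath-arc (_ , _ , inj₁ e) = onPath-up e
  onPath-arc (_ , _ , inj₂ e) = onPath-down e

  walk⇒≤onPath : ∀ {k a b z} → k ≤ a → Walk≥ p k a b → OnPath p a b z → k ≤ z
  walk⇒≤onPath {k} ka ε op = subst (k ≤_) (sym (onPath-self op)) ka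
  walk⇒≤onPath {a = a} {z = z} ka (arc@(_ , ka′ , _) ◅ s) op with z ≟ a
  ... | yes refl = ka
  ... | no z≢a = walk⇒≤onPath ka′ s (onPath-arc arc z≢a op)

  connected⇒≤pathMin : ∀ {k a b m} → Connected≥ p k a b → PathMin p a b m → k ≤ m
  connected⇒≤pathMin (ka , s) (op , _) = walk⇒≤onPath ka s op

  ≤pathMin⇒connected : ∀ {k a b m} → k ≤ m → PathMin p a b m → Connected≥ p k a b
  ≤pathMin⇒connected {k} {a} {b} km (_ , m-min) with nca-exists a b
  ... | c , nca@(ca , cb , _) =
    ≤-trans km (m-min a (nca-onPath nca (inj₁ here) ca)) ,
    climb inj₁ ca ◅◅ walk-reverse p (climb inj₂ cb)
    where
    climb : ∀ {x} → (∀ {z} → Anc p z x → Anc p z a ⊎ Anc p z b) → Anc p c x → Walk≥ p k x c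
    climb side cx = ancestor-walk-self cx λ z zx cz → ≤-trans km (m-min z (nca-onPath nca (side zx) cz))

keepsConnectivity⇒equivalent : ∀ {n} {p q : Parents n} → IsRootedTree p → IsRootedTree q →
  KeepsConnectivity p q → KeepsConnectivity q p → Equivalent p q
keepsConnectivity⇒equivalent tp tq p⇒q q⇒p a b m = transfer tp tq p⇒q q⇒p , transfer tq tp q⇒p p⇒q
  where
  transfer : ∀ {p q} → IsRootedTree p → IsRootedTree q →
    KeepsConnectivity p q → KeepsConnectivity q p → PathMin p a b m → PathMin q a b m
  transfer tp tq p⇒q q⇒p pm with RootedTree.pathMin-exists tq a b
  ... | m′ , qm = subst (PathMin _ a b) (≤-antisym m′≤m m≤m′) qm
    where
    m≤m′ = RootedTree.connected⇒≤pathMin tq (p⇒q (RootedTree.≤pathMin⇒connected tp ≤-refl pm)) qm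
    m′≤m = RootedTree.connected⇒≤pathMin tp (q⇒p (RootedTree.≤pathMin⇒connected tq ≤-refl qm)) pm

equivalent⇒keepsConnectivity : ∀ {n} {p q : Parents n} → IsRootedTree p → IsRootedTree q →
  Equivalent p q → KeepsConnectivity p q
equivalent⇒keepsConnectivity tp tq p≈q {a = a} {b} c with RootedTree.pathMin-exists tq a b
... | m , qm = RootedTree.≤pathMin⇒connected tq
                (RootedTree.connected⇒≤pathMin tp c (proj₂ (p≈q a b m) qm)) qm

module Reroot {n : ℕ} {S : Parents n} (S-tree : IsRootedTree S)
              {v : Fin n} {S′ : Parents n} (rr : IsReroot S v S′) where
  open IsRootedTree S-tree
  open RootedTree S-tree

  private
    S′v≡nothing : S′ v ≡ nothing
    S′v≡nothing = proj₁ rr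

    reversed : ∀ z → Anc S z v → z ≢ v → ∃ λ y → S y ≡ just z × Anc S y v × S′ z ≡ just y
    reversed = proj₁ (proj₂ rr)

    unchanged : ∀ z → ¬ Anc S z v → S′ z ≡ S z
    unchanged = proj₂ (proj₂ rr)

  reversed-arc : ∀ {z y} → Anc S y v → S y ≡ just z → z ≢ v → S′ z ≡ just y
  reversed-arc {z} yv e z≢v with reversed z (anc-trans (anc-parent e) yv) z≢v
  ... | c , Sc≡z , cv , S′z≡c with same-parent-on-chain cv yv Sc≡z e
  ...   | refl = S′z≡c

  reaches-rootward : ∀ {x y} → Anc S x y → Anc S y v → Reaches S′ y → Reaches S′ x
  reaches-rootward here _ ry = ry
  reaches-rootward (step {y = y′} e xy′) yv ry with y′ ≟ v
  ... | yes refl = ⊥-elim (parent-not-anc e yv)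
  ... | no y′≢v = reaches-rootward xy′ (anc-trans (anc-parent e) yv) (up (reversed-arc yv e y′≢v) ry)

  reaches-off-path : ∀ {x} → Reaches S x → ¬ Anc S x v → Reaches S′ x
  reaches-off-path (atRoot e) ¬xv = ⊥-elim (¬xv (parentless-anc v e))
  reaches-off-path {x} (up {y = y} e r) ¬xv with anc? (reaches v) y
  ... | yes yv = up (trans (unchanged x ¬xv) e) (reaches-rootward yv here (atRoot S′v≡nothing))
  ... | no ¬yv = up (trans (unchanged x ¬xv) e) (reaches-off-path r ¬yv)

  reroot-isRootedTree : IsRootedTree S′
  reroot-isRootedTree = record
    { root = v ; root-isRoot = S′v≡nothing ; root-unique = unique ; reaches = reaches′ }
    where
    unique : ∀ x → S′ x ≡ nothing → x ≡ v
    unique x e with anc? (reaches v) x | x ≟ v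
    ... | _      | yes x≡v = x≡v
    ... | no ¬xv | no _    = ⊥-elim (¬xv (parentless-anc v (trans (sym (unchanged x ¬xv)) e)))
    ... | yes xv | no x≢v with reversed x xv x≢v
    ...   | _ , _ , _ , S′x≡y with trans (sym e) S′x≡y
    ...     | ()
    reaches′ : ∀ x → Reaches S′ x
    reaches′ x with anc? (reaches v) x
    ... | yes xv = reaches-rootward xv here (atRoot S′v≡nothing)
    ... | no ¬xv = reaches-off-path (reaches x) ¬xv

  arc⇒reroot-arc : ∀ {x y} → S x ≡ just y → S′ x ≡ just y ⊎ S′ y ≡ just x
  arc⇒reroot-arc {x} {y} e with anc? (reaches v) x | y ≟ v
  ... | no ¬xv | _        = inj₁ (trans (unchanged x ¬xv) e)
  ... | yes xv | yes refl = ⊥-elim (parent-not-anc e xv)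
  ... | yes xv | no y≢v   = inj₂ (reversed-arc xv e y≢v)

  reroot-arc⇒arc : ∀ {x y} → S′ x ≡ just y → S x ≡ just y ⊎ S y ≡ just x
  reroot-arc⇒arc {x} e with anc? (reaches v) x | x ≟ v
  ... | no ¬xv | _        = inj₁ (trans (sym (unchanged x ¬xv)) e)
  ... | yes _  | yes refl with trans (sym S′v≡nothing) e
  ...   | ()
  reroot-arc⇒arc {x} e | yes xv | no x≢v with reversed x xv x≢v
  ...   | _ , Sc≡x , _ , S′x≡c with just-injective (trans (sym S′x≡c) e)
  ...     | refl = inj₂ Sc≡x

  reroot-keepsConnectivity : KeepsConnectivity S S′
  reroot-keepsConnectivity = bridged⇒keepsConnectivity (arcs⇒bridged arc⇒reroot-arc)

  reroot-keepsConnectivity⁻¹ : KeepsConnectivity S′ S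
  reroot-keepsConnectivity⁻¹ = bridged⇒keepsConnectivity (arcs⇒bridged reroot-arc⇒arc)

module _ {n : ℕ} {p : Parents n} (heap : IsHeapOrdered p) where

  anc⇒≤ : ∀ {z x} → Anc p z x → z ≤ x
  anc⇒≤ here = ≤-refl
  anc⇒≤ (step e a) = ≤-trans (anc⇒≤ a) (ℕ.<⇒≤ (proj₂ heap _ _ e))

  nca⇒pathMin : ∀ {a b u} → IsNCA p a b u → PathMin p a b u
  nca⇒pathMin (ua , ub , common) = (inj₁ ua , common) , λ z (_ , on) → anc⇒≤ (on _ ua ub)

module Merge {n : ℕ} {T₁ : Parents n} (heap : IsHeapOrdered T₁)
             {v w : Fin n} {T : Parents n} (merge : IsMerge T₁ v w T) where
  open IsRootedTree (proj₁ heap)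
  open RootedTree (proj₁ heap)

  OnPQ : Fin n → Set
  OnPQ z = Anc T₁ z v ⊎ Anc T₁ z w

  onPQ? : ∀ z → Dec (OnPQ z)
  onPQ? z with anc? (reaches v) z | anc? (reaches w) z
  ... | yes zv | _      = yes (inj₁ zv)
  ... | no _   | yes zw = yes (inj₂ zw)
  ... | no ¬zv | no ¬zw = no [ ¬zv , ¬zw ]

  onPQ-parent : ∀ {x y} → T₁ x ≡ just y → OnPQ x → OnPQ y
  onPQ-parent e = [ inj₁ ∘ anc-trans (anc-parent e) , inj₂ ∘ anc-trans (anc-parent e) ]

  merge-onPQ : ∀ z → OnPQ z →
      (T z ≡ nothing × (∀ y → OnPQ y → ¬ y < z))
    ⊎ (∃ λ y → T z ≡ just y × OnPQ y × y < z × (∀ y′ → OnPQ y′ → y′ < z → y′ ≤ y))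
  merge-onPQ z = proj₁ (merge z)

  merge-offPQ : ∀ z → ¬ OnPQ z → T z ≡ T₁ z
  merge-offPQ z = proj₂ (merge z)

  merge-reaches-onPQ : ∀ {z} → Acc _<_ z → OnPQ z → Reaches T z
  merge-reaches-onPQ {z} (acc below) z∈ with merge-onPQ z z∈
  ... | inj₁ (e , _)                = atRoot e
  ... | inj₂ (y , e , y∈ , y<z , _) = up e (merge-reaches-onPQ (below y<z) y∈)

  merge-reaches : ∀ {z} → Reaches T₁ z → Reaches T z
  merge-reaches {z} r with onPQ? z
  ... | yes z∈ = merge-reaches-onPQ (<-wellFounded z) z∈
  merge-reaches (atRoot e) | no z∉ = atRoot (trans (merge-offPQ _ z∉) e)
  merge-reaches (up e r)   | no z∉ = up (trans (merge-offPQ _ z∉) e) (merge-reaches r)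

  merge-isRootedTree : IsRootedTree T
  merge-isRootedTree = record
    { root = root ; root-isRoot = root-parentless ; root-unique = unique ; reaches = merge-reaches ∘ reaches }
    where
    root∈ : OnPQ root
    root∈ = inj₁ (root-anc v)
    root-parentless : T root ≡ nothing
    root-parentless with merge-onPQ root root∈
    ... | inj₁ (e , _)                = e
    ... | inj₂ (y , _ , _ , y<root , _) = ⊥-elim (ℕ.<⇒≱ y<root (anc⇒≤ heap (root-anc y)))
    unique : ∀ x → T x ≡ nothing → x ≡ root
    unique x e with onPQ? x
    ... | no x∉ = root-unique x (trans (sym (merge-offPQ x x∉)) e)
    ... | yes x∈ with merge-onPQ x x∈
    ...   | inj₁ (_ , x-min) = ≤-antisym (ℕ.≮⇒≥ (x-min root root∈)) (anc⇒≤ heap (root-anc x))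
    ...   | inj₂ (_ , e′ , _) with trans (sym e) e′
    ...     | ()

  -- the merged parent of z is the largest node of P ∪ Q below z, so it is still ≥ x
  descent′ : ∀ {z x} → Acc _<_ z → OnPQ z → OnPQ x → x ≤ z → Walk≥ T x z x
  descent′ {z} {x} (acc below) z∈ x∈ x≤z with x ≟ z
  ... | yes refl = ε
  ... | no x≢z with merge-onPQ z z∈
  ...   | inj₁ (_ , z-min) = ⊥-elim (z-min x x∈ (≤∧≢⇒< x≤z x≢z))
  ...   | inj₂ (y , e , y∈ , y<z , y-max) = (x≤z , x≤y , inj₁ e) ◅ descent′ (below y<z) y∈ x∈ x≤y
    where x≤y = y-max x x∈ (≤∧≢⇒< x≤z x≢z)

  descent : ∀ {z x} → OnPQ z → OnPQ x → x ≤ z → Walk≥ T x z x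
  descent {z} = descent′ (<-wellFounded z)

  merge-walk-vw : ∀ {k} → k ≤ v → k ≤ w → Walk≥ T k v w
  merge-walk-vw kv kw with ≤-total v w
  ... | inj₁ v≤w = walk-antitone T kv (walk-reverse T (descent (inj₂ here) (inj₁ here) v≤w))
  ... | inj₂ w≤v = walk-antitone T kw (descent (inj₁ here) (inj₂ here) w≤v)

  T₁-bridged-by-merge : ArcsBridged T₁ T
  T₁-bridged-by-merge {x = x} e kx ky with onPQ? x
  ... | yes x∈ = walk-antitone T ky (descent x∈ (onPQ-parent e x∈) (anc⇒≤ heap (anc-parent e)))
  ... | no x∉  = arc-walk T (trans (merge-offPQ x x∉) e) kx ky

module CutLink {n : ℕ} {T₁ : Parents n} (heap : IsHeapOrdered T₁)
    {v w u : Fin n} (nca : IsNCA T₁ v w u) (u≢v : u ≢ v)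
    {T : Parents n} (merge : IsMerge T₁ v w T)
    {S : Parents n} (S-tree : IsRootedTree S) (T₁≈S : Equivalent T₁ S)
    {T₁′ : Parents n} (rr : IsReroot S v T₁′)
    {r : Fin n} (T₁′u≡r : T₁′ u ≡ just r) where

  T₁-tree : IsRootedTree T₁
  T₁-tree = proj₁ heap

  T₁′-tree : IsRootedTree T₁′
  T₁′-tree = Reroot.reroot-isRootedTree S-tree rr

  open IsRootedTree T₁′-tree using (root-unique; reaches)
  open RootedTree T₁′-tree using (root-anc; anc-root⇒anc; parent-not-anc)

  T₁′v≡nothing : T₁′ v ≡ nothing
  T₁′v≡nothing = proj₁ rr

  T₁⇒T₁′ : KeepsConnectivity T₁ T₁′
  T₁⇒T₁′ = Reroot.reroot-keepsConnectivity S-tree rr ∘ equivalent⇒keepsConnectivity T₁-tree S-tree T₁≈S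

  T₁′⇒T₁ : KeepsConnectivity T₁′ T₁
  T₁′⇒T₁ = equivalent⇒keepsConnectivity S-tree T₁-tree S≈T₁ ∘ Reroot.reroot-keepsConnectivity⁻¹ S-tree rr
    where
    S≈T₁ : Equivalent S T₁
    S≈T₁ a b m = proj₂ (T₁≈S a b m) , proj₁ (T₁≈S a b m)

  u-pathMin′ : ∀ {a b} → IsNCA T₁ a b u → PathMin T₁′ a b u
  u-pathMin′ {a} {b} nca′ =
    proj₁ (keepsConnectivity⇒equivalent T₁-tree T₁′-tree T₁⇒T₁′ T₁′⇒T₁ a b u) (nca⇒pathMin heap nca′)

  uv-pathMin′ : PathMin T₁′ u v u
  uv-pathMin′ = u-pathMin′ (here , proj₁ nca , λ _ cu _ → cu)

  uw-pathMin′ : PathMin T₁′ u w u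
  uw-pathMin′ = u-pathMin′ (here , proj₁ (proj₂ nca) , λ _ cu _ → cu)

  u≤v : u ≤ v
  u≤v = anc⇒≤ heap (proj₁ nca)

  u≤w : u ≤ w
  u≤w = anc⇒≤ heap (proj₁ (proj₂ nca))

  u-anc′-w : Anc T₁′ u w
  u-anc′-w with proj₁ (proj₁ (u-pathMin′ nca))
  ... | inj₁ uv = ⊥-elim (u≢v (anc-parentless T₁′v≡nothing uv))
  ... | inj₂ uw = uw

  C : Parents n
  C = cutLink T₁′ u v w

  C-v : C v ≡ just w
  C-v with v ≟ v
  ... | yes _   = refl
  ... | no v≢v  = ⊥-elim (v≢v refl)

  C-u : C u ≡ nothing
  C-u with u ≟ v
  ... | yes u≡v = ⊥-elim (u≢v u≡v)
  ... | no _ with u ≟ u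
  ...   | yes _   = refl
  ...   | no u≢u  = ⊥-elim (u≢u refl)

  C-other : ∀ {z} → z ≢ v → z ≢ u → C z ≡ T₁′ z
  C-other {z} z≢v z≢u with z ≟ v
  ... | yes z≡v = ⊥-elim (z≢v z≡v)
  ... | no _ with z ≟ u
  ...   | yes z≡u = ⊥-elim (z≢u z≡u)
  ...   | no _    = refl

  vw-walk : ∀ {k} → k ≤ v → k ≤ w → Walk≥ C k v w
  vw-walk = arc-walk C C-v

  w-to-u : ∀ {k} → k ≤ u → Walk≥ C k w u × Anc C u w
  w-to-u {k} k≤u = ancestor-walk u-anc′-w agree above
    where
    agree : ∀ z → Anc T₁′ z w → Anc T₁′ u z → z ≢ u → C z ≡ T₁′ z
    agree z _ uz = C-other λ { refl → u≢v (anc-parentless T₁′v≡nothing uz) }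
    above : ∀ z → Anc T₁′ z w → Anc T₁′ u z → k ≤ z
    above z zw uz = ≤-trans k≤u (proj₂ uw-pathMin′ z (inj₂ zw , λ _ cu _ → anc-trans cu uz))

  r-to-v : ∀ {k} → k ≤ u → Walk≥ C k r v
  r-to-v {k} k≤u = proj₁ (ancestor-walk (root-anc r) agree above)
    where
    agree : ∀ z → Anc T₁′ z r → Anc T₁′ v z → z ≢ v → C z ≡ T₁′ z
    agree z zr _ z≢v = C-other z≢v λ { refl → parent-not-anc T₁′u≡r zr }
    above : ∀ z → Anc T₁′ z r → Anc T₁′ v z → k ≤ z
    above z zr _ =
      ≤-trans k≤u (proj₂ uv-pathMin′ z (inj₁ (step T₁′u≡r zr) , λ _ _ cv → anc-root⇒anc z cv))

  cutLink-isRootedTree : IsRootedTree C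
  cutLink-isRootedTree = record
    { root = u ; root-isRoot = C-u ; root-unique = unique ; reaches = reaches-C ∘ reaches }
    where
    reaches-v : Reaches C v
    reaches-v = up C-v (reaches-anc (proj₂ (w-to-u ≤-refl)) (atRoot C-u))
    unique : ∀ x → C x ≡ nothing → x ≡ u
    unique x e with toSum (x ≟ v) | toSum (x ≟ u)
    ... | inj₁ refl | _       with trans (sym e) C-v
    ...   | ()
    unique x e | inj₂ _   | inj₁ x≡u = x≡u
    unique x e | inj₂ x≢v | inj₂ x≢u = ⊥-elim (x≢v (root-unique x (trans (sym (C-other x≢v x≢u)) e)))
    reaches-C : ∀ {x} → Reaches T₁′ x → Reaches C x
    reaches-C {x} rx with toSum (x ≟ v) | toSum (x ≟ u)
    ... | inj₁ refl | _         = reaches-v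
    ... | inj₂ _    | inj₁ refl = atRoot C-u
    reaches-C (atRoot e) | inj₂ x≢v | inj₂ _   = ⊥-elim (x≢v (root-unique _ e))
    reaches-C (up e rx)  | inj₂ x≢v | inj₂ x≢u = up (trans (C-other x≢v x≢u) e) (reaches-C rx)

  T₁′⇒T : KeepsConnectivity T₁′ T
  T₁′⇒T = bridged⇒keepsConnectivity (Merge.T₁-bridged-by-merge heap merge) ∘ T₁′⇒T₁

  cutLink-bridged-by-merge : ArcsBridged C T
  cutLink-bridged-by-merge {x = x} e kx ky with toSum (x ≟ v) | toSum (x ≟ u)
  ... | inj₁ refl | _ with just-injective (trans (sym e) C-v)
  ...   | refl = Merge.merge-walk-vw heap merge kx ky
  cutLink-bridged-by-merge e kx ky | inj₂ _ | inj₁ refl with trans (sym e) C-u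
  ...   | ()
  cutLink-bridged-by-merge e kx ky | inj₂ x≢v | inj₂ x≢u =
    proj₂ (T₁′⇒T (kx , arc-walk T₁′ (trans (sym (C-other x≢v x≢u)) e) kx ky))

  u-to-r : ∀ {k} → k ≤ u → Walk≥ C k u r
  u-to-r k≤u =
    walk-reverse C (proj₁ (w-to-u k≤u)) ◅◅
    walk-reverse C (vw-walk (≤-trans k≤u u≤v) (≤-trans k≤u u≤w)) ◅◅
    walk-reverse C (r-to-v k≤u)

  T₁′-bridged-by-cutLink : ArcsBridged T₁′ C
  T₁′-bridged-by-cutLink {x = x} e kx ky with toSum (x ≟ v) | toSum (x ≟ u)
  ... | inj₁ refl | _ with trans (sym T₁′v≡nothing) e
  ...   | ()
  T₁′-bridged-by-cutLink e kx ky | inj₂ _ | inj₁ refl with just-injective (trans (sym e) T₁′u≡r)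
  ...   | refl = u-to-r kx
  T₁′-bridged-by-cutLink e kx ky | inj₂ x≢v | inj₂ x≢u = arc-walk C (trans (C-other x≢v x≢u) e) kx ky

  T₁-walk⇒C-walk : ∀ {k a b} → k ≤ a → Walk≥ T₁ k a b → Walk≥ C k a b
  T₁-walk⇒C-walk ka s = proj₂ (bridged⇒keepsConnectivity T₁′-bridged-by-cutLink (T₁⇒T₁′ (ka , s)))

  walk-up : ∀ {k x z} → Anc T₁ z x → k ≤ z → Walk≥ T₁ k x z
  walk-up zx k≤z = ancestor-walk-self zx λ _ _ zz′ → ≤-trans k≤z (anc⇒≤ heap zz′)

  down-in-C : ∀ {k x z} → Anc T₁ z x → k ≤ z → Walk≥ C k z x
  down-in-C zx k≤z = T₁-walk⇒C-walk k≤z (walk-reverse T₁ (walk-up zx k≤z))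

  up-in-C : ∀ {x z} → Anc T₁ z x → Walk≥ C z x z
  up-in-C zx = T₁-walk⇒C-walk (anc⇒≤ heap zx) (walk-up zx ≤-refl)

  onPQ-walk : ∀ {x y} → Merge.OnPQ heap merge x → Merge.OnPQ heap merge y → y ≤ x → Walk≥ C y x y
  onPQ-walk (inj₁ xv) (inj₁ yv) y≤x = down-in-C xv y≤x ◅◅ up-in-C yv
  onPQ-walk (inj₂ xw) (inj₂ yw) y≤x = down-in-C xw y≤x ◅◅ up-in-C yw
  onPQ-walk (inj₁ xv) (inj₂ yw) y≤x =
    down-in-C xv y≤x ◅◅ vw-walk (≤-trans y≤x (anc⇒≤ heap xv)) (anc⇒≤ heap yw) ◅◅ up-in-C yw
  onPQ-walk (inj₂ xw) (inj₁ yv) y≤x =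
    down-in-C xw y≤x ◅◅ walk-reverse C (vw-walk (anc⇒≤ heap yv) (≤-trans y≤x (anc⇒≤ heap xw))) ◅◅ up-in-C yv

  merge-bridged-by-cutLink : ArcsBridged T C
  merge-bridged-by-cutLink {x = x} e kx ky with Merge.onPQ? heap merge x
  ... | no x∉ = T₁-walk⇒C-walk kx (arc-walk T₁ (trans (sym (Merge.merge-offPQ heap merge x x∉)) e) kx ky)
  ... | yes x∈ with Merge.merge-onPQ heap merge x x∈
  ...   | inj₁ (e′ , _) with trans (sym e) e′
  ...     | ()
  merge-bridged-by-cutLink e kx ky | yes x∈ | inj₂ (_ , e′ , y∈ , y<x , _)
    with just-injective (trans (sym e) e′)
  ... | refl = walk-antitone C ky (onPQ-walk x∈ y∈ (ℕ.<⇒≤ y<x))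

lemma8 : ∀ {n} (T₁ : Parents n) → IsHeapOrdered T₁ →
    (v w u : Fin n) → IsNCA T₁ v w u → ¬ (u ≡ v) → ¬ (u ≡ w) →
    (T : Parents n) → IsMerge T₁ v w T →
    (S : Parents n) → IsRootedTree S → Equivalent T₁ S →
    (T₁' : Parents n) → IsReroot S v T₁' →
    (r : Fin n) → T₁' u ≡ just r →
    Equivalent (cutLink T₁' u v w) T
lemma8 T₁ heap v w u nca u≢v _ T merge S S-tree T₁≈S T₁′ rr r T₁′u≡r =
  keepsConnectivity⇒equivalent
    cutLink-isRootedTree
    (Merge.merge-isRootedTree heap merge)
    (bridged⇒keepsConnectivity cutLink-bridged-by-merge)
    (bridged⇒keepsConnectivity merge-bridged-by-cutLink)
  where open CutLink heap nca u≢v merge S-tree T₁≈S rr T₁′u≡r
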